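{- Not both players can win in a position of Infinite Hex: there is no configuration of the Infinite Hex board containing both a winning Red $\mathbb{Z}$-chain and a winning Blue $\mathbb{Z}$-chain.
   Context: Infinite Hex board: cells are pairs $(a,j)$ with $j\in\mathbb{Z}$ and $a\in\mathbb{Z}+j/2$ ($a$ = West–East position, $j$ = South–North row); $(a,j),(a',j')$ are adjacent iff ($j=j'$ and $|a-a'|=1$) or ($|j-j'|=1$ and $|a-a'|=1/2$). A configuration marks each cell as empty, Red or Blue. A Red (resp. Blue) $\mathbb{Z}$-chain is a map $r:\mathbb{Z}\to$ cells such that every $r(n)$ is Red (resp. Blue) and $r(n),r(n+1)$ are adjacent for every $n\in\mathbb{Z}$. For a cell $h_0=(a_0,j_0)$, a Red chain $r$ is winning with respect to $h_0$ if there is $M\in\mathbb{N}$ such that for all $m\ge M$, $r(m)=(a,j)$ satisfies $a>a_0$ and $j>j_0$, and $r(-m)=(a,j)$ satisfies $a<a_0$ and $j<j_0$. A Blue chain $b$ is winning with respect to $h_0$ if there is $M$ such that for all $m\ge M$, $b(m)$ satisfies $a<a_0$, $j>j_0$ and $b(-m)$ satisfies $a>a_0$, $j<j_0$. A chain is winning if it is winning with respect to every cell $h_0$. -}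

module Defs where

open import Data.Integer using (ℤ; +_; _-_; _<_; _>_; ∣_∣)
open import Data.Integer.Divisibility using (_∣_)
open import Data.Nat using (ℕ; _≥_)
open import Data.Product using (Σ; _×_; ∃-syntax)
open import Data.Sum using (_⊎_)
open import Relation.Binary.PropositionalEquality using (_≡_)

-- A cell (a , j) with a ∈ ℤ + j/2 is encoded by doubled abscissa x = 2a ∈ ℤ
-- together with the row j ∈ ℤ, subject to the parity constraint x ≡ j (mod 2).
record Cell : Set where
  constructor cell
  field
    x      : ℤ
    j      : ℤ          -- South–North row
    parity : + 2 ∣ (x - j)
open Cell public

-- Adjacency (in doubled coordinates):
--   same row and |a - a'| = 1  ⇔  j = j' and |x - x'| = 2
--   |j - j'| = 1 and |a - a'| = 1/2  ⇔  |j - j'| = 1 and |x - x'| = 1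
Adjacent : Cell → Cell → Set
Adjacent c d =
  (j c ≡ j d × ∣ x c - x d ∣ ≡ 2)
  ⊎ (∣ j c - j d ∣ ≡ 1 × ∣ x c - x d ∣ ≡ 1)

data Colour : Set where
  empty red blue : Colour

Configuration : Set
Configuration = Cell → Colour

IsChain : Configuration → Colour → (ℤ → Cell) → Set
IsChain σ col r = (∀ n → σ (r n) ≡ col) × (∀ n → Adjacent (r n) (r (n Data.Integer.+ + 1)))

RedWinningWrt : (ℤ → Cell) → Cell → Set
RedWinningWrt r h₀ = ∃[ M ] ∀ (m : ℕ) → m ≥ M →
  (x (r (+ m)) > x h₀ × j (r (+ m)) > j h₀)
  × (x (r (Data.Integer.- (+ m))) < x h₀ × j (r (Data.Integer.- (+ m))) < j h₀)

BlueWinningWrt : (ℤ → Cell) → Cell → Set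
BlueWinningWrt b h₀ = ∃[ M ] ∀ (m : ℕ) → m ≥ M →
  (x (b (+ m)) < x h₀ × j (b (+ m)) > j h₀)
  × (x (b (Data.Integer.- (+ m))) > x h₀ × j (b (Data.Integer.- (+ m))) < j h₀)

WinningRedChain : Configuration → (ℤ → Cell) → Set
WinningRedChain σ r = IsChain σ red r × (∀ h₀ → RedWinningWrt r h₀)

WinningBlueChain : Configuration → (ℤ → Cell) → Set
WinningBlueChain σ b = IsChain σ blue b × (∀ h₀ → BlueWinningWrt b h₀)

-- For a finite red path ρ and a cell p off it, count modulo 2 the edges of ρ
-- that cross the ray running east from p between p's row and the next one.
-- Moving p to a neighbouring cell off ρ changes the parity by a term that
-- depends only on the two ends of ρ and vanishes when neither end is on the
-- rows of the two cells.  So the parity is constant along a blue path that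
-- avoids ρ and whose rows lie strictly between those of ρ's ends.  At a blue
-- cell east of every red cell on its row the ray meets no red edge, so the
-- parity is 0; at a blue cell west of every red cell on its row each change
-- of ρ between that row and the next is a crossing, so the parity is 1 since
-- ρ climbs from below to above.  Long enough segments of winning Red and Blue
-- chains form such a configuration: far along, the Blue chain lies north-west
-- and south-east of the finitely many Red cells not yet far north-east or
-- south-west.

module Submission where

open import Defs
open import Data.Integer using (ℤ)
open import Data.Product using (_×_; ∃-syntax)
open import Relation.Nullary using (¬_)

open import Algebra.Bundles using (CommutativeRing)
open import Data.Bool.Base using (Bool; true; false; _∧_; _xor_)
open import Data.Bool.Properties
  using (xor-∧-commutativeRing; xor-assoc; xor-comm; xor-same; xor-identityʳ)
open import Algebra.Properties.CommutativeSemigroup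
  (CommutativeRing.+-commutativeSemigroup xor-∧-commutativeRing) using (interchange)
open import Data.Empty using (⊥-elim)
open import Data.Integer.Base
  using (+_; -[1+_]; -_; _+_; _-_; _≤_; _<_; ∣_∣; +<+; +≤+; -≤-; -≤+)
import Data.Integer.Properties as ℤP
open import Data.Integer.Divisibility using (_∣_)
import Data.Integer.Divisibility.Signed as Signed
open import Data.Integer.Tactic.RingSolver using (solve-∀)
open import Data.Nat.Base as ℕ using (ℕ; zero; suc; z≤n; s≤s; _⊔_)
import Data.Nat.Properties as ℕP
open import Data.Nat.Divisibility using (divides)
open import Data.Product using (_,_; proj₁; proj₂)
open import Data.Sum using (_⊎_; inj₁; inj₂)
open import Function.Base using (_∘_; case_of_)
open import Function.Bundles using (_⇔_; mk⇔; Equivalence)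
open import Function.Properties.Equivalence
  using () renaming (refl to ⇔-refl; sym to ⇔-sym; trans to ⇔-trans)
open import Relation.Binary.Definitions using (tri<; tri≈; tri>)
open import Relation.Nullary.Decidable
  using (Dec; yes; no; does; _×-dec_; dec-true; dec-false; does-⇔)
open import Relation.Binary.PropositionalEquality

i≡j+[i-j] : ∀ i j → i ≡ j + (i - j)
i≡j+[i-j] = solve-∀

i-j≡k⇒i≡j+k : ∀ i j {k} → i - j ≡ k → i ≡ j + k
i-j≡k⇒i≡j+k i j refl = i≡j+[i-j] i j

i-j≡-k⇒j≡i+k : ∀ i j {k} → i - j ≡ - k → j ≡ i + k
i-j≡-k⇒j≡i+k i j {k} eq =
  trans (j≡i+-[i-j] i j) (cong (λ t → i + t) (trans (cong -_ eq) (ℤP.neg-involutive k)))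
  where
  j≡i+-[i-j] : ∀ i j → j ≡ i + - (i - j)
  j≡i+-[i-j] = solve-∀

[i+a]-[j+b]≡[i-j]+[a-b] : ∀ i j a b → (i + a) - (j + b) ≡ (i - j) + (a - b)
[i+a]-[j+b]≡[i-j]+[a-b] = solve-∀

i-[j+a]≡[i-j]-a : ∀ i j a → i - (j + a) ≡ (i - j) + - a
i-[j+a]≡[i-j]-a = solve-∀

[i+a]-j≡[i-j]+a : ∀ i j a → (i + a) - j ≡ (i - j) + a
[i+a]-j≡[i-j]+a = solve-∀

[i+a]-[j+a]≡i-j : ∀ i j a → (i + a) - (j + a) ≡ i - j
[i+a]-[j+a]≡i-j = solve-∀

[i-a]-[j-a]≡i-j : ∀ i j a → (i - a) - (j - a) ≡ i - j
[i-a]-[j-a]≡i-j = solve-∀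

≡⇔-≡0 : ∀ {a b} → a ≡ b ⇔ a - b ≡ + 0
≡⇔-≡0 {a} {b} = mk⇔ ℤP.i≡j⇒i-j≡0 (ℤP.i-j≡0⇒i≡j a b)

<⇔0<- : ∀ {a b} → a < b ⇔ + 0 < b - a
<⇔0<- {a} {b} = mk⇔
  (λ a<b → subst (_< b - a) (ℤP.+-inverseʳ a) (ℤP.+-monoˡ-< (- a) a<b))
  (λ 0<b-a → subst₂ _<_ (ℤP.+-identityˡ a) (sym (i≡j+[i-j]′ b a)) (ℤP.+-monoˡ-< a 0<b-a))
  where
  i≡j+[i-j]′ : ∀ i j → i ≡ (i - j) + j
  i≡j+[i-j]′ = solve-∀

i<i+1 : ∀ i → i < i + + 1
i<i+1 i = ℤP.suc[i]≤j⇒i<j (ℤP.≤-reflexive (ℤP.+-comm (+ 1) i))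

i<j⇒i+1≤j : ∀ {i j} → i < j → i + + 1 ≤ j
i<j⇒i+1≤j {i} i<j = subst (_≤ _) (ℤP.+-comm (+ 1) i) (ℤP.i<j⇒suc[i]≤j i<j)

∣i∣≡n⇒i≡±n : ∀ {i n} → ∣ i ∣ ≡ n → i ≡ + n ⊎ i ≡ - + n
∣i∣≡n⇒i≡±n {+ _}    refl = inj₁ refl
∣i∣≡n⇒i≡±n { -[1+ _ ]} refl = inj₂ refl

∣i∣≤n⇒-n≤i≤n : ∀ {i n} → ∣ i ∣ ℕ.≤ n → - + n ≤ i × i ≤ + n
∣i∣≤n⇒-n≤i≤n {+ _}       ∣i∣≤n       = ℤP.neg-≤-pos , +≤+ ∣i∣≤n
∣i∣≤n⇒-n≤i≤n { -[1+ _ ]} (s≤s ∣i∣≤n) = -≤- ∣i∣≤n , -≤+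

even⇒0<⇔0<+2 : ∀ {i} → + 2 ∣ i → i ≢ + 0 → (+ 0 < i ⇔ + 0 < i + + 2)
even⇒0<⇔0<+2 {+ zero}        _                    i≢0 = ⊥-elim (i≢0 refl)
even⇒0<⇔0<+2 {+ suc _}       _                    _   =
  mk⇔ (λ _ → +<+ (s≤s z≤n)) (λ _ → +<+ (s≤s z≤n))
even⇒0<⇔0<+2 { -[1+ zero ]}  (divides zero ())    _
even⇒0<⇔0<+2 { -[1+ zero ]}  (divides (suc _) ()) _
even⇒0<⇔0<+2 { -[1+ suc n ]} _                    _   = mk⇔ (λ ()) (⊥-elim ∘ ℤP.≤⇒≯ i+2≤0)
  where
  i+2≤0 : -[1+ suc n ] + + 2 ≤ + 0
  i+2≤0 = subst (_≤ + 0) (sym (ℤP.⊖-≤ {2} {suc (suc n)} (s≤s (s≤s z≤n)))) (ℤP.neg-≤-pos {n})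

data Shift : ℤ → Set where
  shift0  : Shift (+ 0)
  shift+2 : Shift (+ 2)
  shift-2 : Shift (- + 2)

even⇒0<-shift : ∀ {i k s} → Shift s → k ≡ i + s →
                + 2 ∣ i → + 2 ∣ k → i ≢ + 0 → k ≢ + 0 → + 0 < i ⇔ + 0 < k
even⇒0<-shift {i} shift0 refl _ _ _ _ =
  subst (λ t → + 0 < i ⇔ + 0 < t) (sym (ℤP.+-identityʳ i)) ⇔-refl
even⇒0<-shift shift+2 refl 2∣i _ i≢0 _ = even⇒0<⇔0<+2 2∣i i≢0
even⇒0<-shift {i} shift-2 refl _ 2∣k _ k≢0 =
  ⇔-sym (subst (λ t → + 0 < i - + 2 ⇔ + 0 < t) (i-2+2≡i i) (even⇒0<⇔0<+2 2∣k k≢0))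
  where
  i-2+2≡i : ∀ i → (i - + 2) + + 2 ≡ i
  i-2+2≡i = solve-∀

cell-≡ : ∀ {c d} → x c ≡ x d → j c ≡ j d → c ≡ d
cell-≡ {cell u v (divides q e)} {cell .u .v (divides q′ e′)} refl refl
  with ℕP.*-cancelʳ-≡ q q′ 2 (trans (sym e) e′)
... | refl = cong (cell u v ∘ divides q) (ℕP.≡-irrelevant e e′)

same-row⇒even : ∀ {c p} → j c ≡ j p → + 2 ∣ (x c - x p)
same-row⇒even {c} {p} row = Signed.∣⇒∣ᵤ {i = x c - x p} (subst (Signed._∣_ (+ 2)) difference
  (Signed.∣m∣n⇒∣m-n (Signed.∣ᵤ⇒∣ {i = x c - j c} (parity c)) (Signed.∣ᵤ⇒∣ {i = x p - j p} (parity p))))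
  where
  difference : (x c - j c) - (x p - j p) ≡ x c - x p
  difference = trans (cong (λ t → (x c - t) - (x p - j p)) row) ([i-a]-[j-a]≡i-j (x c) (x p) (j p))

origin : Cell
origin = cell (+ 0) (+ 0) (divides 0 refl)

diagonalCell : ℤ → Cell
diagonalCell i = cell i i (subst (+ 2 ∣_) (sym (ℤP.+-inverseʳ i)) (divides 0 refl))

data Diagonal : ℤ → Set where
  right : Diagonal (+ 1)
  left  : Diagonal (- + 1)

data Step (c d : Cell) : Set where
  east  : x d ≡ x c + + 2 → j d ≡ j c → Step c d
  north : ∀ {a} → Diagonal a → x d ≡ x c + a → j d ≡ j c + + 1 → Step c d

diagonal-shift : ∀ {a b} → Diagonal a → Diagonal b → Shift (a - b)
diagonal-shift right right = shift0
diagonal-shift right left  = shift+2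
diagonal-shift left  right = shift-2
diagonal-shift left  left  = shift0

∣i∣≡1⇒diagonal : ∀ i → ∣ i ∣ ≡ 1 → Diagonal i
∣i∣≡1⇒diagonal (+ 1)         refl = right
∣i∣≡1⇒diagonal -[1+ 0 ]      refl = left

adjacent⇒step : ∀ {c d} → Adjacent c d → Step c d ⊎ Step d c
adjacent⇒step {c} {d} (inj₁ (row , ∣dx∣≡2)) with ∣i∣≡n⇒i≡±n {x c - x d} ∣dx∣≡2
... | inj₁ dx≡2  = inj₂ (east (i-j≡k⇒i≡j+k (x c) (x d) dx≡2) row)
... | inj₂ dx≡-2 = inj₁ (east (i-j≡-k⇒j≡i+k (x c) (x d) dx≡-2) (sym row))
adjacent⇒step {c} {d} (inj₂ (∣dj∣≡1 , ∣dx∣≡1)) with ∣i∣≡n⇒i≡±n {j c - j d} ∣dj∣≡1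
... | inj₁ dj≡1  = inj₂ (north (∣i∣≡1⇒diagonal _ ∣dx∣≡1)
                               (i≡j+[i-j] (x c) (x d)) (i-j≡k⇒i≡j+k (j c) (j d) dj≡1))
... | inj₂ dj≡-1 = inj₁ (north (∣i∣≡1⇒diagonal _ (trans (ℤP.∣i-j∣≡∣j-i∣ (x d) (x c)) ∣dx∣≡1))
                               (i≡j+[i-j] (x d) (x c)) (i-j≡-k⇒j≡i+k (j c) (j d) dj≡-1))

adjacent-wlog : (P : Cell → Cell → Set) → (∀ {c d} → P c d → P d c) →
                (∀ {c d} → Step c d → P c d) → ∀ {c d} → Adjacent c d → P c d
adjacent-wlog P P-sym P-step adj with adjacent⇒step adj
... | inj₁ c→d = P-step c→d
... | inj₂ d→c = P-sym (P-step d→c)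

EastRay : Cell → Cell → Set
EastRay p c = j c ≡ j p × x p < x c

eastRay? : ∀ p c → Dec (EastRay p c)
eastRay? p c = j c ℤP.≟ j p ×-dec x p ℤP.<? x c

onEastRay : Cell → Cell → Bool
onEastRay p c = does (eastRay? p c)

isAbove : Cell → Cell → Bool
isAbove p c = does (j p ℤP.<? j c)

eastRay-transport : ∀ {p c q d s} → Shift s →
                    j d - j q ≡ j c - j p → x d - x q ≡ (x c - x p) + s →
                    c ≢ p → d ≢ q → EastRay p c ⇔ EastRay q d
eastRay-transport {p} {c} {q} {d} s dj dx c≢p d≢q = mk⇔
  (λ (row , p<c) → let row′ = Equivalence.to same-row row in
     row′ , Equivalence.to (east-of row row′) p<c)
  (λ (row′ , q<d) → let row = Equivalence.from same-row row′ in
     row , Equivalence.from (east-of row row′) q<d)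
  where
  same-row : j c ≡ j p ⇔ j d ≡ j q
  same-row = ⇔-trans ≡⇔-≡0 (⇔-trans (mk⇔ (trans dj) (trans (sym dj))) (⇔-sym ≡⇔-≡0))

  east-of : j c ≡ j p → j d ≡ j q → x p < x c ⇔ x q < x d
  east-of row row′ = ⇔-trans <⇔0<- (⇔-trans
    (even⇒0<-shift s dx (same-row⇒even {c} {p} row) (same-row⇒even {d} {q} row′)
      (λ dx≡0 → c≢p (cell-≡ (ℤP.i-j≡0⇒i≡j _ _ dx≡0) row))
      (λ dx≡0 → d≢q (cell-≡ (ℤP.i-j≡0⇒i≡j _ _ dx≡0) row′)))
    (⇔-sym <⇔0<-))

-- For adjacent c and d, an end above p lies on the row just above p's ray.
crossesRay : Cell → Cell → Cell → Bool
crossesRay p c d = (onEastRay p c ∧ isAbove p d) xor (onEastRay p d ∧ isAbove p c)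

crossesRay-sym : ∀ p c d → crossesRay p c d ≡ crossesRay p d c
crossesRay-sym p c d = xor-comm (onEastRay p c ∧ isAbove p d) (onEastRay p d ∧ isAbove p c)

does-∧-implied : ∀ {A B : Set} → (A → B) → (a? : Dec A) (b? : Dec B) →
                 does a? ∧ does b? ≡ does a?
does-∧-implied A⇒B (yes a) b? = dec-true b? (A⇒B a)
does-∧-implied A⇒B (no _)  b? = refl

does-∧-excluded : ∀ {A B : Set} → (A → ¬ B) → (a? : Dec A) (b? : Dec B) →
                  does a? ∧ does b? ≡ false
does-∧-excluded A⇒¬B (yes a) b? = dec-false b? (A⇒¬B a)
does-∧-excluded A⇒¬B (no _)  b? = refl

onEastRay∧isAbove-≤ : ∀ {p c d} → j d ≤ j c → onEastRay p c ∧ isAbove p d ≡ false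
onEastRay∧isAbove-≤ {p} {c} {d} d≤c =
  does-∧-excluded (λ (row , _) → ℤP.≤⇒≯ (subst (j d ≤_) row d≤c))
                  (eastRay? p c) (j p ℤP.<? j d)

crossesRay-flat : ∀ p c d → j d ≡ j c → crossesRay p c d ≡ false
crossesRay-flat p c d row = cong₂ _xor_
  (onEastRay∧isAbove-≤ {p} {c} {d} (ℤP.≤-reflexive row))
  (onEastRay∧isAbove-≤ {p} {d} {c} (ℤP.≤-reflexive (sym row)))

crossesRay-up : ∀ p c d → j d ≡ j c + + 1 → crossesRay p c d ≡ onEastRay p c
crossesRay-up p c d up = trans
  (cong₂ _xor_ (does-∧-implied (λ (row , _) → subst (_< j d) row c<d) (eastRay? p c) (j p ℤP.<? j d))
               (onEastRay∧isAbove-≤ {p} {d} {c} (ℤP.<⇒≤ c<d)))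
  (xor-identityʳ (onEastRay p c))
  where
  c<d : j c < j d
  c<d = subst (j c <_) (sym up) (i<i+1 (j c))

onEastRay-transport : ∀ {p c q d s} → Shift s →
                      j d - j q ≡ j c - j p → x d - x q ≡ (x c - x p) + s →
                      c ≢ p → d ≢ q → onEastRay p c ≡ onEastRay q d
onEastRay-transport {p} {c} {q} {d} s dj dx c≢p d≢q =
  does-⇔ (eastRay-transport s dj dx c≢p d≢q) (eastRay? p c) (eastRay? q d)

-- Edges crossing the ray of exactly one of p and q: none when q is p's east
-- neighbour (such an edge would end in q), and those with one end on q's ray
-- when q is a row up.
rowCorrection : ∀ {p q} → Step p q → Cell → Bool
rowCorrection             (east _ _)    c = false
rowCorrection {q = q} (north _ _ _) c = onEastRay q c

crossesRay-step-forward : ∀ {p q c d} (s : Step p q) → Step c d →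
  c ≢ p → c ≢ q → d ≢ p → d ≢ q →
  crossesRay p c d xor crossesRay q c d ≡ rowCorrection s c xor rowCorrection s d
crossesRay-step-forward {p} {q} {c} {d} (east _ _) (east _ row) _ _ _ _ =
  cong₂ _xor_ (crossesRay-flat p c d row) (crossesRay-flat q c d row)
crossesRay-step-forward {p} {q} {c} {d} (east xq jq) (north _ _ up) c≢p c≢q _ _ = begin
  crossesRay p c d xor crossesRay q c d
    ≡⟨ cong₂ _xor_ (crossesRay-up p c d up) (crossesRay-up q c d up) ⟩
  onEastRay p c xor onEastRay q c
    ≡⟨ cong (_xor onEastRay q c) (onEastRay-transport shift-2 dj dx c≢p c≢q) ⟩
  onEastRay q c xor onEastRay q c
    ≡⟨ xor-same (onEastRay q c) ⟩
  false ∎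
  where
  open ≡-Reasoning
  dj : j c - j q ≡ j c - j p
  dj = cong (λ t → j c - t) jq
  dx : x c - x q ≡ (x c - x p) + - + 2
  dx = trans (cong (λ t → x c - t) xq) (i-[j+a]≡[i-j]-a (x c) (x p) (+ 2))
crossesRay-step-forward {p} {q} {c} {d} (north _ _ _) (east xd row) _ c≢q _ d≢q = begin
  crossesRay p c d xor crossesRay q c d
    ≡⟨ cong₂ _xor_ (crossesRay-flat p c d row) (crossesRay-flat q c d row) ⟩
  false
    ≡⟨ xor-same (onEastRay q c) ⟨
  onEastRay q c xor onEastRay q c
    ≡⟨ cong (onEastRay q c xor_) (onEastRay-transport shift+2 dj dx c≢q d≢q) ⟩
  onEastRay q c xor onEastRay q d ∎
  where
  open ≡-Reasoning
  dj : j d - j q ≡ j c - j q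
  dj = cong (_- j q) row
  dx : x d - x q ≡ (x c - x q) + + 2
  dx = trans (cong (_- x q) xd) ([i+a]-j≡[i-j]+a (x c) (x q) (+ 2))
crossesRay-step-forward {p} {q} {c} {d} (north {l} l-diag xq jq) (north {a} a-diag xd up)
                        c≢p _ _ d≢q = begin
  crossesRay p c d xor crossesRay q c d
    ≡⟨ cong₂ _xor_ (crossesRay-up p c d up) (crossesRay-up q c d up) ⟩
  onEastRay p c xor onEastRay q c
    ≡⟨ cong (_xor onEastRay q c)
            (onEastRay-transport (diagonal-shift a-diag l-diag) dj dx c≢p d≢q) ⟩
  onEastRay q d xor onEastRay q c
    ≡⟨ xor-comm (onEastRay q d) (onEastRay q c) ⟩
  onEastRay q c xor onEastRay q d ∎
  where
  open ≡-Reasoning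
  dj : j d - j q ≡ j c - j p
  dj = trans (cong₂ _-_ up jq) ([i+a]-[j+a]≡i-j (j c) (j p) (+ 1))
  dx : x d - x q ≡ (x c - x p) + (a - l)
  dx = trans (cong₂ _-_ xd xq) ([i+a]-[j+b]≡[i-j]+[a-b] (x c) (x p) a l)

crossesRay-step : ∀ {p q c d} (s : Step p q) → Adjacent c d →
  c ≢ p → c ≢ q → d ≢ p → d ≢ q →
  crossesRay p c d xor crossesRay q c d ≡ rowCorrection s c xor rowCorrection s d
crossesRay-step {p} {q} {c} {d} s adj = adjacent-wlog P
  (λ {c} {d} P-cd d≢p d≢q c≢p c≢q → trans
     (cong₂ _xor_ (crossesRay-sym p d c) (crossesRay-sym q d c))
     (trans (P-cd c≢p c≢q d≢p d≢q) (xor-comm (rowCorrection s c) (rowCorrection s d))))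
  (crossesRay-step-forward s) {c} {d} adj
  where
  P : Cell → Cell → Set
  P c d = c ≢ p → c ≢ q → d ≢ p → d ≢ q →
          crossesRay p c d xor crossesRay q c d ≡ rowCorrection s c xor rowCorrection s d

xorSum : (ℕ → Bool) → ℕ → Bool
xorSum f zero    = false
xorSum f (suc n) = xorSum f n xor f n

xorSum-xor : ∀ f g n → xorSum f n xor xorSum g n ≡ xorSum (λ i → f i xor g i) n
xorSum-xor f g zero    = refl
xorSum-xor f g (suc n) =
  trans (interchange (xorSum f n) (f n) (xorSum g n) (g n)) (cong (_xor (f n xor g n)) (xorSum-xor f g n))

xorSum-telescope : ∀ f (g : ℕ → Bool) → (∀ i → f i ≡ g i xor g (suc i)) →
                   ∀ n → xorSum f n ≡ g 0 xor g n
xorSum-telescope f g f≡Δg zero    = sym (xor-same (g 0))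
xorSum-telescope f g f≡Δg (suc n) = begin
  xorSum f n xor f n
    ≡⟨ cong₂ _xor_ (xorSum-telescope f g f≡Δg n) (f≡Δg n) ⟩
  (g 0 xor g n) xor (g n xor g (suc n))
    ≡⟨ xor-assoc (g 0) (g n) _ ⟩
  g 0 xor (g n xor (g n xor g (suc n)))
    ≡⟨ cong (g 0 xor_) (xor-assoc (g n) (g n) (g (suc n))) ⟨
  g 0 xor ((g n xor g n) xor g (suc n))
    ≡⟨ cong (λ t → g 0 xor (t xor g (suc n))) (xor-same (g n)) ⟩
  g 0 xor g (suc n) ∎
  where open ≡-Reasoning

IsPath : (ℕ → Cell) → Set
IsPath ρ = ∀ i → Adjacent (ρ i) (ρ (suc i))

crossings : Cell → (ℕ → Cell) → ℕ → Bool
crossings p ρ = xorSum (λ i → crossesRay p (ρ i) (ρ (suc i)))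

RowBetween : (ℕ → Cell) → ℕ → Cell → Set
RowBetween ρ n p = j (ρ 0) < j p × j p < j (ρ n)

crossings-step : ∀ {p q ρ} (s : Step p q) → IsPath ρ →
                 (∀ i → ρ i ≢ p) → (∀ i → ρ i ≢ q) →
                 ∀ n → RowBetween ρ n q → crossings p ρ n ≡ crossings q ρ n
crossings-step {p} {q} {ρ} s path ≢p ≢q n (start<q , q<end) = xor≡false⇒≡ (begin
  crossings p ρ n xor crossings q ρ n
    ≡⟨ xorSum-xor _ _ n ⟩
  xorSum (λ i → crossesRay p (ρ i) (ρ (suc i)) xor crossesRay q (ρ i) (ρ (suc i))) n
    ≡⟨ xorSum-telescope _ (rowCorrection s ∘ ρ)
         (λ i → crossesRay-step s (path i) (≢p i) (≢q i) (≢p (suc i)) (≢q (suc i))) n ⟩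
  rowCorrection s (ρ 0) xor rowCorrection s (ρ n)
    ≡⟨ cong₂ _xor_ (off-row (ρ 0) s (ℤP.<⇒≢ start<q))
                   (off-row (ρ n) s (ℤP.<⇒≢ q<end ∘ sym)) ⟩
  false ∎)
  where
  open ≡-Reasoning
  xor≡false⇒≡ : ∀ {a b} → a xor b ≡ false → a ≡ b
  xor≡false⇒≡ {false} {false} _ = refl
  xor≡false⇒≡ {true}  {true}  _ = refl
  off-row : ∀ c (s : Step p q) → j c ≢ j q → rowCorrection s c ≡ false
  off-row c (east _ _)    _    = refl
  off-row c (north _ _ _) row≢ = dec-false (eastRay? q c) (row≢ ∘ proj₁)

crossings-adjacent : ∀ {p q ρ} → Adjacent p q → IsPath ρ →
                     (∀ i → ρ i ≢ p) → (∀ i → ρ i ≢ q) → ∀ n →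
                     RowBetween ρ n p → RowBetween ρ n q → crossings p ρ n ≡ crossings q ρ n
crossings-adjacent adj path ≢p ≢q n p-between q-between with adjacent⇒step adj
... | inj₁ p→q = crossings-step p→q path ≢p ≢q n q-between
... | inj₂ q→p = sym (crossings-step q→p path ≢q ≢p n p-between)

LeftOf : {I : Set} → Cell → (I → Cell) → Set
LeftOf p f = ∀ i → j (f i) ≡ j p → x p < x (f i)

RightOf : {I : Set} → Cell → (I → Cell) → Set
RightOf p f = ∀ i → j (f i) ≡ j p → x (f i) < x p

isAbove-xor-up : ∀ p c d → j d ≡ j c + + 1 → isAbove p c xor isAbove p d ≡ does (j c ℤP.≟ j p)
isAbove-xor-up p c d up with ℤP.<-cmp (j p) (j c)
... | tri< p<c _ _ = trans
  (cong₂ _xor_ (dec-true (j p ℤP.<? j c) p<c) (dec-true (j p ℤP.<? j d) (ℤP.<-trans p<c c<d)))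
  (sym (dec-false (j c ℤP.≟ j p) (ℤP.<⇒≢ p<c ∘ sym)))
  where
  c<d : j c < j d
  c<d = subst (j c <_) (sym up) (i<i+1 (j c))
... | tri≈ _ p≡c _ = trans
  (cong₂ _xor_ (dec-false (j p ℤP.<? j c) (ℤP.<-irrefl p≡c)) (dec-true (j p ℤP.<? j d) p<d))
  (sym (dec-true (j c ℤP.≟ j p) (sym p≡c)))
  where
  p<d : j p < j d
  p<d = subst₂ _<_ (sym p≡c) (sym up) (i<i+1 (j c))
... | tri> _ _ c<p = trans
  (cong₂ _xor_ (dec-false (j p ℤP.<? j c) (ℤP.<-asym c<p)) (dec-false (j p ℤP.<? j d) (ℤP.≤⇒≯ d≤p)))
  (sym (dec-false (j c ℤP.≟ j p) (ℤP.<⇒≢ c<p)))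
  where
  d≤p : j d ≤ j p
  d≤p = subst (_≤ j p) (sym up) (i<j⇒i+1≤j c<p)

crossesRay-leftOf : ∀ {p c d} → Adjacent c d →
                    (j c ≡ j p → x p < x c) → (j d ≡ j p → x p < x d) →
                    crossesRay p c d ≡ isAbove p c xor isAbove p d
crossesRay-leftOf {p} {c} {d} adj = adjacent-wlog P
  (λ {c} {d} P-cd d-east c-east → trans (crossesRay-sym p d c)
     (trans (P-cd c-east d-east) (xor-comm (isAbove p c) (isAbove p d))))
  forward {c} {d} adj
  where
  P : Cell → Cell → Set
  P c d = (j c ≡ j p → x p < x c) → (j d ≡ j p → x p < x d) →
          crossesRay p c d ≡ isAbove p c xor isAbove p d
  forward : ∀ {c d} → Step c d → P c d
  forward {c} {d} (east _ row) _ _ = trans (crossesRay-flat p c d row)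
    (sym (trans (cong (λ t → isAbove p c xor does (j p ℤP.<? t)) row) (xor-same (isAbove p c))))
  forward {c} {d} (north _ _ up) c-east _ = trans (crossesRay-up p c d up)
    (trans (does-⇔ (mk⇔ proj₁ (λ row → row , c-east row)) (eastRay? p c) (j c ℤP.≟ j p))
           (sym (isAbove-xor-up p c d up)))

crossesRay-rightOf : ∀ {p c d} → Adjacent c d →
                     (j c ≡ j p → x c < x p) → (j d ≡ j p → x d < x p) → crossesRay p c d ≡ false
crossesRay-rightOf {p} {c} {d} adj = adjacent-wlog P
  (λ {c} {d} P-cd d-west c-west → trans (crossesRay-sym p d c) (P-cd c-west d-west))
  forward {c} {d} adj
  where
  P : Cell → Cell → Set
  P c d = (j c ≡ j p → x c < x p) → (j d ≡ j p → x d < x p) → crossesRay p c d ≡ false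
  forward : ∀ {c d} → Step c d → P c d
  forward {c} {d} (east _ row)   _      _ = crossesRay-flat p c d row
  forward {c} {d} (north _ _ up) c-west _ = trans (crossesRay-up p c d up)
    (dec-false (eastRay? p c) (λ (row , p<c) → ℤP.<-asym p<c (c-west row)))

crossings-leftOf : ∀ {p ρ} → IsPath ρ → LeftOf p ρ →
                   ∀ n → crossings p ρ n ≡ isAbove p (ρ 0) xor isAbove p (ρ n)
crossings-leftOf {p} {ρ} path p-left = xorSum-telescope _ (isAbove p ∘ ρ)
  (λ i → crossesRay-leftOf {p} {ρ i} {ρ (suc i)} (path i) (p-left i) (p-left (suc i)))

crossings-rightOf : ∀ {p ρ} → IsPath ρ → RightOf p ρ → ∀ n → crossings p ρ n ≡ false
crossings-rightOf {p} {ρ} path p-right = xorSum-telescope _ (λ _ → false)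
  (λ i → crossesRay-rightOf {p} {ρ i} {ρ (suc i)} (path i) (p-right i) (p-right (suc i)))

crossings-along : ∀ {ρ β} n K → IsPath ρ → IsPath β → (∀ i k → ρ i ≢ β k) →
                  (∀ k → k ℕ.≤ K → RowBetween ρ n (β k)) →
                  ∀ k → k ℕ.≤ K → crossings (β 0) ρ n ≡ crossings (β k) ρ n
crossings-along n K ρ-path β-path disjoint between zero    _    = refl
crossings-along {ρ} {β} n K ρ-path β-path disjoint between (suc k) k<K =
  trans (crossings-along n K ρ-path β-path disjoint between k k≤K)
        (crossings-adjacent (β-path k) ρ-path (λ i → disjoint i k) (λ i → disjoint i (suc k)) n
           (between k k≤K) (between (suc k) k<K))
  where
  k≤K : k ℕ.≤ K
  k≤K = ℕP.<⇒≤ k<K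

crossing-paths-meet : ∀ {ρ β} n K → IsPath ρ → IsPath β →
                      (∀ k → k ℕ.≤ K → RowBetween ρ n (β k)) →
                      RightOf (β 0) ρ → LeftOf (β K) ρ → ¬ (∀ i k → ρ i ≢ β k)
crossing-paths-meet {ρ} {β} n K ρ-path β-path between start end disjoint = false≢true (begin
  false
    ≡⟨ crossings-rightOf {β 0} {ρ} ρ-path start n ⟨
  crossings (β 0) ρ n
    ≡⟨ crossings-along n K ρ-path β-path disjoint between K ℕP.≤-refl ⟩
  crossings (β K) ρ n
    ≡⟨ crossings-leftOf {β K} {ρ} ρ-path end n ⟩
  isAbove (β K) (ρ 0) xor isAbove (β K) (ρ n)
    ≡⟨ cong₂ _xor_ (dec-false (j (β K) ℤP.<? j (ρ 0)) (ℤP.<-asym ρ0<βK))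
                   (dec-true (j (β K) ℤP.<? j (ρ n)) βK<ρn) ⟩
  true ∎)
  where
  open ≡-Reasoning
  ρ0<βK = proj₁ (between K ℕP.≤-refl)
  βK<ρn = proj₂ (between K ℕP.≤-refl)
  false≢true : false ≢ true
  false≢true ()

Eventually : (ℕ → Set) → Set
Eventually P = ∃[ M ] ∀ m → m ℕ.≥ M → P m

eventually-× : ∀ {P Q} → Eventually P → Eventually Q → Eventually (λ m → P m × Q m)
eventually-× (M , P-from) (N , Q-from) = M ⊔ N , λ m M⊔N≤m →
  P-from m (ℕP.≤-trans (ℕP.m≤m⊔n M N) M⊔N≤m) ,
  Q-from m (ℕP.≤-trans (ℕP.m≤n⊔m M N) M⊔N≤m)

eventually-witness : ∀ {P} → Eventually P → ∃[ m ] P m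
eventually-witness (M , P-from) = M , P-from M ℕP.≤-refl

maxUpTo : (ℕ → ℕ) → ℕ → ℕ
maxUpTo g zero    = g 0
maxUpTo g (suc n) = maxUpTo g n ⊔ g (suc n)

≤-maxUpTo : ∀ g {i n} → i ℕ.≤ n → g i ℕ.≤ maxUpTo g n
≤-maxUpTo g {n = zero}      z≤n   = ℕP.≤-refl
≤-maxUpTo g {i} {suc n} i≤1+n with ℕP.m≤n⇒m<n∨m≡n i≤1+n
... | inj₁ i<1+n = ℕP.≤-trans (≤-maxUpTo g (ℕP.≤-pred i<1+n)) (ℕP.m≤m⊔n _ _)
... | inj₂ refl  = ℕP.m≤n⊔m _ _

bounded-on : ∀ (f : ℤ → ℤ) N → ∃[ B ] ∀ n → ∣ n ∣ ℕ.≤ N → - + B ≤ f n × f n ≤ + B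
bounded-on f N = maxUpTo g N , bound
  where
  g : ℕ → ℕ
  g m = ∣ f (+ m) ∣ ⊔ ∣ f (- + m) ∣
  bound : ∀ n → ∣ n ∣ ℕ.≤ N → - + maxUpTo g N ≤ f n × f n ≤ + maxUpTo g N
  bound (+ m)     m≤N = ∣i∣≤n⇒-n≤i≤n (ℕP.≤-trans (ℕP.m≤m⊔n _ _) (≤-maxUpTo g m≤N))
  bound -[1+ m ] m<N = ∣i∣≤n⇒-n≤i≤n (ℕP.≤-trans (ℕP.m≤n⊔m _ _) (≤-maxUpTo g m<N))

index-cases : ∀ N n → (∃[ m ] N ℕ.≤ m × n ≡ + m) ⊎ (∃[ m ] N ℕ.≤ m × n ≡ - + m) ⊎
                      ∣ n ∣ ℕ.≤ N
index-cases N (+ m) with N ℕP.≤? m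
... | yes N≤m = inj₁ (m , N≤m , refl)
... | no  N≰m = inj₂ (inj₂ (ℕP.<⇒≤ (ℕP.≰⇒> N≰m)))
index-cases N -[1+ m ] with N ℕP.≤? suc m
... | yes N≤m = inj₂ (inj₁ (suc m , N≤m , refl))
... | no  N≰m = inj₂ (inj₂ (ℕP.<⇒≤ (ℕP.≰⇒> N≰m)))

red-leftOf-northwest : ∀ r → (∀ h → RedWinningWrt r h) →
                       ∃[ B ] ∀ p → x p < - + B → + 0 < j p → LeftOf p r
red-leftOf-northwest r win with win origin
... | N , far with bounded-on (λ n → x (r n)) N
... | B , bound = B , λ p p-west p-north n row → case index-cases N n of λ where
  (inj₁ (m , N≤m , refl)) →
    ℤP.<-trans (ℤP.<-≤-trans p-west ℤP.neg-≤-pos) (proj₁ (proj₁ (far m N≤m)))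
  (inj₂ (inj₁ (m , N≤m , refl))) →
    ⊥-elim (ℤP.<-asym p-north (subst (_< + 0) row (proj₂ (proj₂ (far m N≤m)))))
  (inj₂ (inj₂ ∣n∣≤N)) → ℤP.<-≤-trans p-west (proj₁ (bound n ∣n∣≤N))

red-rightOf-southeast : ∀ r → (∀ h → RedWinningWrt r h) →
                        ∃[ B ] ∀ p → + B < x p → j p < + 0 → RightOf p r
red-rightOf-southeast r win with win origin
... | N , far with bounded-on (λ n → x (r n)) N
... | B , bound = B , λ p p-east p-south n row → case index-cases N n of λ where
  (inj₁ (m , N≤m , refl)) →
    ⊥-elim (ℤP.<-asym p-south (subst (+ 0 <_) row (proj₂ (proj₁ (far m N≤m)))))
  (inj₂ (inj₁ (m , N≤m , refl))) →
    ℤP.<-trans (proj₁ (proj₂ (far m N≤m))) (ℤP.≤-<-trans (+≤+ z≤n) p-east)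
  (inj₂ (inj₂ ∣n∣≤N)) → ℤP.≤-<-trans (proj₂ (bound n ∣n∣≤N)) p-east

red-ends : ∀ r → (∀ h → RedWinningWrt r h) →
           ∀ H → ∃[ K ] j (r (- + K)) < - + H × + H < j (r (+ K))
red-ends r win H with eventually-witness
  (eventually-× (win (diagonalCell (- + H))) (win (diagonalCell (+ H))))
... | K , below , above = K , proj₂ (proj₂ below) , proj₂ (proj₁ above)

blue-ends : ∀ b → (∀ h → BlueWinningWrt b h) → ∀ Bw Be →
            ∃[ M ] (x (b (+ M)) < - + Bw × + 0 < j (b (+ M))) ×
                   (+ Be < x (b (- + M)) × j (b (- + M)) < + 0)
blue-ends b win Bw Be with eventually-witness
  (eventually-× (win origin) (eventually-× (win (diagonalCell (- + Bw))) (win (diagonalCell (+ Be)))))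
... | M , around-origin , west-of-Bw , east-of-Be =
  M , (proj₁ (proj₁ west-of-Bw) , proj₂ (proj₁ around-origin)) ,
      (proj₁ (proj₂ east-of-Be) , proj₂ (proj₂ around-origin))

segment : (ℤ → Cell) → ℕ → ℕ → Cell
segment f N i = f (+ i - + N)

segment-start : ∀ f N → segment f N 0 ≡ f (- + N)
segment-start f N = cong f (ℤP.+-identityˡ (- + N))

segment-end : ∀ f N → segment f N (N ℕ.+ N) ≡ f (+ N)
segment-end f N = cong f ([a+a]-a≡a (+ N))
  where
  [a+a]-a≡a : ∀ a → (a + a) - a ≡ a
  [a+a]-a≡a = solve-∀

segment-path : ∀ f → (∀ n → Adjacent (f n) (f (n + + 1))) → ∀ N → IsPath (segment f N)
segment-path f adj N i =
  subst (λ n → Adjacent (segment f N i) (f n)) (sym ([1+a]-b≡[a-b]+1 (+ i) (+ N))) (adj (+ i - + N))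
  where
  [1+a]-b≡[a-b]+1 : ∀ a b → (+ 1 + a) - b ≡ (a - b) + + 1
  [1+a]-b≡[a-b]+1 = solve-∀

winning-chains-meet : ∀ r b →
  (∀ n → Adjacent (r n) (r (n + + 1))) → (∀ n → Adjacent (b n) (b (n + + 1))) →
  (∀ h → RedWinningWrt r h) → (∀ h → BlueWinningWrt b h) → ¬ (∀ n k → r n ≢ b k)
winning-chains-meet r b r-adj b-adj r-win b-win disjoint
  with red-leftOf-northwest r r-win | red-rightOf-southeast r r-win
... | Bw , leftOf-r | Be , rightOf-r with blue-ends b b-win Bw Be
... | M , (bM-west , bM-north) , (b-M-east , b-M-south)
  with red-ends r r-win (maxUpTo (λ k → ∣ j (segment b M k) ∣) (M ℕ.+ M))
... | K , r-K-below , rK-above =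
  crossing-paths-meet (K ℕ.+ K) (M ℕ.+ M) (segment-path r r-adj K) (segment-path b b-adj M)
    between start end (λ i k → disjoint _ _)
  where
  ρ = segment r K
  β = segment b M
  H = maxUpTo (λ k → ∣ j (β k) ∣) (M ℕ.+ M)

  between : ∀ k → k ℕ.≤ M ℕ.+ M → RowBetween ρ (K ℕ.+ K) (β k)
  between k k≤2M =
    ℤP.<-≤-trans (subst (λ c → j c < - + H) (sym (segment-start r K)) r-K-below) (proj₁ row-bound) ,
    ℤP.≤-<-trans (proj₂ row-bound) (subst (λ c → + H < j c) (sym (segment-end r K)) rK-above)
    where
    row-bound = ∣i∣≤n⇒-n≤i≤n (≤-maxUpTo (λ k → ∣ j (β k) ∣) k≤2M)

  start : RightOf (β 0) ρ
  start = subst (λ p → RightOf p ρ) (sym (segment-start b M))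
    (λ i → rightOf-r (b (- + M)) b-M-east b-M-south (+ i - + K))

  end : LeftOf (β (M ℕ.+ M)) ρ
  end = subst (λ p → LeftOf p ρ) (sym (segment-end b M))
    (λ i → leftOf-r (b (+ M)) bM-west bM-north (+ i - + K))

proposition2p13 : ∀ (σ : Configuration) →
    ¬ (∃[ r ] WinningRedChain σ r × ∃[ b ] WinningBlueChain σ b)
proposition2p13 σ (r , ((r-red , r-adj) , r-win) , b , ((b-blue , b-adj) , b-win)) =
  winning-chains-meet r b r-adj b-adj r-win b-win
    (λ n k r≡b → red≢blue (trans (sym (r-red n)) (trans (cong σ r≡b) (b-blue k))))
  where
  red≢blue : red ≢ blue
  red≢blue ()
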